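{- Let $n$ be an odd positive integer and let $T$ be the tree obtained from the star $K_{1,(n-1)/2}$ by subdividing each edge exactly once (so $T$ has $n$ vertices). Then \[ \chi_{2K_2}(T) = \left\lceil \sqrt{n - \frac34} + \frac12 \right\rceil . \]
   Context: All graphs are finite and simple. $K_{1,m}$ is the star with $m$ leaves; subdividing an edge $uv$ means replacing it by a path $u w v$ through a new vertex $w$. $2K_2$ denotes the graph consisting of two disjoint edges. For a fixed bipartite graph $H$, a proper vertex coloring of a graph $G$ is called an $H$-avoiding coloring if for any two color classes, the subgraph of $G$ induced by their union contains no induced subgraph isomorphic to $H$. $\chi_H(G)$ denotes the minimum number of colors in an $H$-avoiding coloring of $G$. -}

module Defs where

open import Data.Nat using (ℕ; zero; suc; _+_; _*_; _∸_; _^_; _≤_; _<_)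
open import Data.Fin using (Fin; toℕ)
open import Data.Product using (Σ; _×_; ∃)
open import Data.Sum using (_⊎_)
open import Relation.Nullary using (¬_)
open import Relation.Binary.PropositionalEquality using (_≡_; _≢_)

-- Vertex 0 is the centre, vertices 1..k are
-- the subdivision vertices, vertices k+1..2k are the leaves; the leaf
-- k+i is attached to the subdivision vertex i.  (Edges: 0–i and i–(i+k)
-- for 1 ≤ i ≤ k; the relation below is the symmetric adjacency.)

data SpiderAdjℕ (k : ℕ) : ℕ → ℕ → Set where
  centre-mid : ∀ i → 1 ≤ i → i ≤ k → SpiderAdjℕ k 0 i
  mid-centre : ∀ i → 1 ≤ i → i ≤ k → SpiderAdjℕ k i 0
  mid-leaf   : ∀ i → 1 ≤ i → i ≤ k → SpiderAdjℕ k i (i + k)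
  leaf-mid   : ∀ i → 1 ≤ i → i ≤ k → SpiderAdjℕ k (i + k) i

SpiderAdj : (k : ℕ) → Fin (suc (k + k)) → Fin (suc (k + k)) → Set
SpiderAdj k u v = SpiderAdjℕ k (toℕ u) (toℕ v)

Induced2K2 : {n : ℕ} → (Fin n → Fin n → Set) → Fin n → Fin n → Fin n → Fin n → Set
Induced2K2 Adj a b c d =
  (a ≢ b) × (a ≢ c) × (a ≢ d) × (b ≢ c) × (b ≢ d) × (c ≢ d) ×
  Adj a b × Adj c d ×
  ¬ Adj a c × ¬ Adj a d × ¬ Adj b c × ¬ Adj b d

InPair : {m : ℕ} → Fin m → Fin m → Fin m → Set
InPair i j x = (x ≡ i) ⊎ (x ≡ j)

IsProper : {n m : ℕ} → (Fin n → Fin n → Set) → (Fin n → Fin m) → Set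
IsProper Adj f = ∀ u v → Adj u v → f u ≢ f v

Is2K2Avoiding : {n m : ℕ} → (Fin n → Fin n → Set) → (Fin n → Fin m) → Set
Is2K2Avoiding {n} {m} Adj f =
  IsProper Adj f ×
  (∀ (i j : Fin m) (a b c d : Fin n) →
     InPair i j (f a) → InPair i j (f b) → InPair i j (f c) → InPair i j (f d) →
     ¬ Induced2K2 Adj a b c d)

Has2K2AvoidingColouring : {n : ℕ} → (Fin n → Fin n → Set) → ℕ → Set
Has2K2AvoidingColouring {n} Adj m = Σ (Fin n → Fin m) (λ f → Is2K2Avoiding Adj f)

Chi2K2≡ : {n : ℕ} → (Fin n → Fin n → Set) → ℕ → Set
Chi2K2≡ Adj m =
  Has2K2AvoidingColouring Adj m ×
  (∀ c → Has2K2AvoidingColouring Adj c → m ≤ c)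

-- m = ⌈ √(n − 3/4) + 1/2 ⌉, characterised (exactly, by squaring) as
--   m − 1 < √(n − 3/4) + 1/2 ≤ m.
-- Upper:  √(n−3/4) ≤ m − 1/2  ⇔  1 ≤ m  and  4n − 3 ≤ (2m − 1)².
-- Lower:  m − 3/2 < √(n−3/4)  ⇔  2m < 3  or  (2m − 3)² < 4n − 3.
-- (n ≥ 1, so 4n − 3 ≥ 1 and no truncation occurs in the ℕ arithmetic.)
IsCeilSqrtFormula : ℕ → ℕ → Set
IsCeilSqrtFormula n m =
  (1 ≤ m × 4 * n ≤ (2 * m ∸ 1) ^ 2 + 3) ×
  (2 * m < 3 ⊎ (2 * m ∸ 3) ^ 2 + 3 < 4 * n)

{-# OPTIONS --safe #-}
module Submission where

-- A proper colouring of the subdivided star is 2K₂-avoiding exactly when the pendant edges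
-- (mid vertex – leaf) of distinct legs receive distinct pairs of colours: every induced 2K₂
-- consists of two such edges, and any two of them form one.  These colour pairs are
-- 2-subsets of the colour set, so χ_{2K₂}(T) is the least positive c with k ≤ C(c, 2).  For
-- the upper bound the centre gets colour 0 and leg ℓ the ℓ-th 2-subset in colex order, its
-- mid vertex taking the larger colour so that it differs from the centre.  Finally
-- (2c − 1)² + 3 = 4 (1 + 2 C(c, 2)), so that least c is ⌈√(n − 3/4) + 1/2⌉ for n = 2k + 1.

open import Data.Nat hiding (_≟_)
open import Data.Nat.Properties hiding (suc-injective; _≟_)
open import Data.Nat.Combinatorics using (_C_; nC1≡n; nCk+nC[k+1]≡[n+1]C[k+1])
open import Data.Nat.Tactic.RingSolver using (solve-∀)
open import Relation.Binary.PropositionalEquality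
open import Relation.Binary.Definitions using (tri<; tri≈; tri>)
open import Data.Product
open import Data.Empty using (⊥-elim)
open import Relation.Nullary using (¬_; yes; no)
open import Data.Fin using (Fin; zero; suc; toℕ; fromℕ<; inject≤; _↑ˡ_; _↑ʳ_; splitAt)
open import Data.Fin.Properties
  using (toℕ<n; toℕ-fromℕ<; toℕ-injective; injective⇒≤; inject≤-injective; _≟_;
         toℕ-↑ˡ; toℕ-↑ʳ; ↑ˡ-injective; ↑ʳ-injective; splitAt-↑ˡ; splitAt-↑ʳ; suc-injective)
open import Data.Sum using (inj₁; inj₂; [_,_]′)
open import Relation.Nullary.Decidable using (decidable-stable)
open import Function using (_∘_)
open import Function.Definitions using (Injective)
open import Defs

[1+n]C2≡nC2+n : ∀ n → suc n C 2 ≡ n C 2 + n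
[1+n]C2≡nC2+n n = begin
  suc n C 2      ≡⟨ nCk+nC[k+1]≡[n+1]C[k+1] n 1 ⟨
  n C 1 + n C 2  ≡⟨ cong (_+ n C 2) (nC1≡n n) ⟩
  n + n C 2      ≡⟨ +-comm n (n C 2) ⟩
  n C 2 + n      ∎
  where open ≡-Reasoning

C2-mono-≤ : ∀ {m n} → m ≤ n → m C 2 ≤ n C 2
C2-mono-≤ z≤n = z≤n
C2-mono-≤ {suc m} {suc n} (s≤s m≤n) = begin
  suc m C 2  ≡⟨ [1+n]C2≡nC2+n m ⟩
  m C 2 + m  ≤⟨ +-mono-≤ (C2-mono-≤ m≤n) m≤n ⟩
  n C 2 + n  ≡⟨ [1+n]C2≡nC2+n n ⟨
  suc n C 2  ∎
  where open ≤-Reasoning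

[1+n]C2+[1+n]C2≡n*n+n : ∀ n → suc n C 2 + suc n C 2 ≡ n * n + n
[1+n]C2+[1+n]C2≡n*n+n zero = refl
[1+n]C2+[1+n]C2≡n*n+n (suc n) = begin
  suc (suc n) C 2 + suc (suc n) C 2
    ≡⟨ cong (λ t → t + t) ([1+n]C2≡nC2+n (suc n)) ⟩
  (suc n C 2 + suc n) + (suc n C 2 + suc n)
    ≡⟨ regroup (suc n C 2) (suc n) ⟩
  (suc n C 2 + suc n C 2) + (suc n + suc n)
    ≡⟨ cong (_+ (suc n + suc n)) ([1+n]C2+[1+n]C2≡n*n+n n) ⟩
  (n * n + n) + (suc n + suc n)
    ≡⟨ square-step n ⟩
  suc n * suc n + suc n ∎
  where
  open ≡-Reasoning
  regroup : ∀ t a → (t + a) + (t + a) ≡ (t + t) + (a + a)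
  regroup = solve-∀
  square-step : ∀ n → (n * n + n) + (suc n + suc n) ≡ suc n * suc n + suc n
  square-step = solve-∀

-- The position of {l, h} (l < h) in the colexicographic order of the 2-subsets of ℕ.
pairCode : ℕ → ℕ → ℕ
pairCode h l = h C 2 + l

pairCode<C2 : ∀ {h l c} → l < h → h < c → pairCode h l < c C 2
pairCode<C2 {h} {l} {c} l<h h<c = begin-strict
  h C 2 + l  <⟨ +-monoʳ-< (h C 2) l<h ⟩
  h C 2 + h  ≡⟨ [1+n]C2≡nC2+n h ⟨
  suc h C 2  ≤⟨ C2-mono-≤ h<c ⟩
  c C 2      ∎
  where open ≤-Reasoning

pairCode<C2⇒< : ∀ {h l c} → pairCode h l < c C 2 → h < c
pairCode<C2⇒< {h} {l} code< = ≰⇒> λ c≤h → <⇒≱ code< (≤-trans (C2-mono-≤ c≤h) (m≤m+n (h C 2) l))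

pairCode-injective : ∀ {h l h' l'} → l < h → l' < h' →
  pairCode h l ≡ pairCode h' l' → h ≡ h' × l ≡ l'
pairCode-injective {h} {l} {h'} {l'} l<h l'<h' eq with <-cmp h h'
... | tri< h<h' _ _ = ⊥-elim (<⇒≱ (pairCode<C2 l<h h<h') (subst (h' C 2 ≤_) (sym eq) (m≤m+n (h' C 2) l')))
... | tri≈ _ refl _ = refl , +-cancelˡ-≡ (h C 2) l l' eq
... | tri> _ _ h'<h = ⊥-elim (<⇒≱ (pairCode<C2 l'<h' h'<h) (subst (h C 2 ≤_) eq (m≤m+n (h C 2) l)))

record CodedPair (n : ℕ) : Set where
  field
    hi lo  : ℕ
    lo<hi  : lo < hi
    code≡n : pairCode hi lo ≡ n

pairCode-surjective : ∀ n → CodedPair n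
pairCode-surjective zero = record { hi = 1 ; lo = 0 ; lo<hi = z<s ; code≡n = refl }
pairCode-surjective (suc n) with pairCode-surjective n
... | record { hi = h ; lo = l ; lo<hi = l<h ; code≡n = code≡n } with suc l <? h
...   | yes 1+l<h = record
  { hi = h ; lo = suc l ; lo<hi = 1+l<h ; code≡n = trans (+-suc (h C 2) l) (cong suc code≡n) }
...   | no 1+l≮h = record { hi = suc h ; lo = 0 ; lo<hi = z<s ; code≡n = carry }
  where
  open ≡-Reasoning
  carry : pairCode (suc h) 0 ≡ suc n
  carry = begin
    suc h C 2 + 0       ≡⟨ +-identityʳ _ ⟩
    suc h C 2           ≡⟨ [1+n]C2≡nC2+n h ⟩
    h C 2 + h           ≡⟨ cong (h C 2 +_) (≤-antisym (≮⇒≥ 1+l≮h) l<h) ⟩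
    h C 2 + suc l       ≡⟨ +-suc (h C 2) l ⟩
    suc (pairCode h l)  ≡⟨ cong suc code≡n ⟩
    suc n               ∎

record OrderedPair (c : ℕ) : Set where
  field
    hi lo : Fin c
    lo<hi : toℕ lo < toℕ hi

open OrderedPair

rank : ∀ {c} → OrderedPair c → Fin (c C 2)
rank p = fromℕ< (pairCode<C2 (lo<hi p) (toℕ<n (hi p)))

toℕ-rank : ∀ {c} (p : OrderedPair c) → toℕ (rank p) ≡ pairCode (toℕ (hi p)) (toℕ (lo p))
toℕ-rank p = toℕ-fromℕ< _

rank-cong : ∀ {c} {p q : OrderedPair c} → hi p ≡ hi q → lo p ≡ lo q → rank p ≡ rank q
rank-cong {p = p} {q} hi≡ lo≡ =
  toℕ-injective (trans (toℕ-rank p)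
    (trans (cong₂ (λ h l → pairCode (toℕ h) (toℕ l)) hi≡ lo≡) (sym (toℕ-rank q))))

rank-injective : ∀ {c} {p q : OrderedPair c} → rank p ≡ rank q → hi p ≡ hi q × lo p ≡ lo q
rank-injective {p = p} {q} eq with pairCode-injective (lo<hi p) (lo<hi q)
                                     (trans (sym (toℕ-rank p)) (trans (cong toℕ eq) (toℕ-rank q)))
... | hi≡ , lo≡ = toℕ-injective hi≡ , toℕ-injective lo≡

unrank : ∀ {c} → Fin (c C 2) → OrderedPair c
unrank {c} n = record
  { hi    = fromℕ< h<c
  ; lo    = fromℕ< (<-trans l<h h<c)
  ; lo<hi = subst₂ _<_ (sym (toℕ-fromℕ< _)) (sym (toℕ-fromℕ< _)) l<h
  }
  where
  open CodedPair (pairCode-surjective (toℕ n)) renaming (hi to h; lo to l; lo<hi to l<h)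
  h<c : h < c
  h<c = pairCode<C2⇒< (subst (_< c C 2) (sym code≡n) (toℕ<n n))

rank-unrank : ∀ {c} (n : Fin (c C 2)) → rank (unrank {c} n) ≡ n
rank-unrank {c} n = toℕ-injective (begin
  toℕ (rank (unrank {c} n))
    ≡⟨ toℕ-rank (unrank {c} n) ⟩
  pairCode (toℕ (hi (unrank {c} n))) (toℕ (lo (unrank {c} n)))
    ≡⟨ cong₂ pairCode (toℕ-fromℕ< {m = h} _) (toℕ-fromℕ< {m = l} _) ⟩
  pairCode h l
    ≡⟨ code≡n ⟩
  toℕ n ∎)
  where
  open ≡-Reasoning
  open CodedPair (pairCode-surjective (toℕ n)) renaming (hi to h; lo to l)

data SamePair {A : Set} : A → A → A → A → Set where
  same    : ∀ {x y} → SamePair x y x y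
  swapped : ∀ {x y} → SamePair x y y x

samePair-≡ : ∀ {A : Set} {x y z w : A} → x ≡ z → y ≡ w → SamePair x y z w
samePair-≡ refl refl = same

samePair-sym : ∀ {A : Set} {x y z w : A} → SamePair x y z w → SamePair z w x y
samePair-sym same    = same
samePair-sym swapped = swapped

samePair-trans : ∀ {A : Set} {x y z w s t : A} →
  SamePair x y z w → SamePair z w s t → SamePair x y s t
samePair-trans same    p       = p
samePair-trans swapped same    = swapped
samePair-trans swapped swapped = same

samePair-map : ∀ {A B : Set} (f : A → B) {x y z w : A} →
  SamePair x y z w → SamePair (f x) (f y) (f z) (f w)
samePair-map f same    = same
samePair-map f swapped = swapped

samePair⇒inPair : ∀ {m} {x y z w : Fin m} → SamePair x y z w → InPair x y z × InPair x y w
samePair⇒inPair same    = inj₁ refl , inj₂ refl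
samePair⇒inPair swapped = inj₂ refl , inj₁ refl

inPair⇒samePair : ∀ {m} {p q x y z w : Fin m} →
  InPair p q x → InPair p q y → InPair p q z → InPair p q w → x ≢ y → z ≢ w → SamePair x y z w
inPair⇒samePair (inj₁ refl) (inj₁ refl) _ _ x≢y _ = ⊥-elim (x≢y refl)
inPair⇒samePair (inj₂ refl) (inj₂ refl) _ _ x≢y _ = ⊥-elim (x≢y refl)
inPair⇒samePair _ _ (inj₁ refl) (inj₁ refl) _ z≢w = ⊥-elim (z≢w refl)
inPair⇒samePair _ _ (inj₂ refl) (inj₂ refl) _ z≢w = ⊥-elim (z≢w refl)
inPair⇒samePair (inj₁ refl) (inj₂ refl) (inj₁ refl) (inj₂ refl) _ _ = same
inPair⇒samePair (inj₁ refl) (inj₂ refl) (inj₂ refl) (inj₁ refl) _ _ = swapped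
inPair⇒samePair (inj₂ refl) (inj₁ refl) (inj₁ refl) (inj₂ refl) _ _ = swapped
inPair⇒samePair (inj₂ refl) (inj₁ refl) (inj₂ refl) (inj₁ refl) _ _ = same

samePair-ordered : ∀ {c} {h l h' l' : Fin c} → toℕ l < toℕ h → toℕ l' < toℕ h' →
  SamePair h l h' l' → h ≡ h' × l ≡ l'
samePair-ordered _   _   same    = refl , refl
samePair-ordered l<h h<l swapped = ⊥-elim (<-asym l<h h<l)

sortPair : ∀ {c} {x y : Fin c} → x ≢ y → Σ (OrderedPair c) λ p → SamePair x y (hi p) (lo p)
sortPair {x = x} {y} x≢y with <-cmp (toℕ x) (toℕ y)
... | tri< x<y _ _ = record { hi = y ; lo = x ; lo<hi = x<y } , swapped
... | tri≈ _ x≡y _ = ⊥-elim (x≢y (toℕ-injective x≡y))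
... | tri> _ _ y<x = record { hi = x ; lo = y ; lo<hi = y<x } , same

PairInjective : ∀ {k} {A : Set} → (Fin k → A) → (Fin k → A) → Set
PairInjective A B = ∀ ℓ ℓ' → SamePair (A ℓ) (B ℓ) (A ℓ') (B ℓ') → ℓ ≡ ℓ'

pairInjective⇒≤C2 : ∀ {k c} (A B : Fin k → Fin c) →
  (∀ ℓ → A ℓ ≢ B ℓ) → PairInjective A B → k ≤ c C 2
pairInjective⇒≤C2 {k} {c} A B A≢B injective = injective⇒≤ rank-sorted-injective
  where
  sorted : Fin k → OrderedPair c
  sorted ℓ = proj₁ (sortPair (A≢B ℓ))
  sorted-same : ∀ ℓ → SamePair (A ℓ) (B ℓ) (hi (sorted ℓ)) (lo (sorted ℓ))
  sorted-same ℓ = proj₂ (sortPair (A≢B ℓ))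
  rank-sorted-injective : Injective _≡_ _≡_ (rank ∘ sorted)
  rank-sorted-injective {ℓ} {ℓ'} eq with rank-injective {p = sorted ℓ} {sorted ℓ'} eq
  ... | hi≡ , lo≡ = injective ℓ ℓ'
    (samePair-trans (sorted-same ℓ) (samePair-trans (samePair-≡ hi≡ lo≡) (samePair-sym (sorted-same ℓ'))))

≤C2⇒∃pairInjective : ∀ {k c} → k ≤ c C 2 →
  Σ (Fin k → OrderedPair c) λ P → PairInjective (hi ∘ P) (lo ∘ P)
≤C2⇒∃pairInjective {k} {c} k≤c₂ = P , P-injective
  where
  P : Fin k → OrderedPair c
  P ℓ = unrank (inject≤ ℓ k≤c₂)
  P-injective : PairInjective (hi ∘ P) (lo ∘ P)
  P-injective ℓ ℓ' samePair with samePair-ordered (lo<hi (P ℓ)) (lo<hi (P ℓ')) samePair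
  ... | hi≡ , lo≡ = inject≤-injective k≤c₂ k≤c₂ ℓ ℓ' (begin
    inject≤ ℓ k≤c₂           ≡⟨ rank-unrank {c} _ ⟨
    rank (P ℓ)               ≡⟨ rank-cong {p = P ℓ} {P ℓ'} hi≡ lo≡ ⟩
    rank (P ℓ')              ≡⟨ rank-unrank {c} _ ⟩
    inject≤ ℓ' k≤c₂          ∎)
    where open ≡-Reasoning

Vertex : ℕ → Set
Vertex k = Fin (suc (k + k))

module _ {k : ℕ} where

  centre : Vertex k
  centre = zero

  mid leaf : Fin k → Vertex k
  mid ℓ  = suc (ℓ ↑ˡ k)
  leaf ℓ = suc (k ↑ʳ ℓ)

  toℕ-mid : ∀ ℓ → toℕ (mid ℓ) ≡ suc (toℕ ℓ)
  toℕ-mid ℓ = cong suc (toℕ-↑ˡ ℓ k)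

  toℕ-leaf : ∀ ℓ → toℕ (leaf ℓ) ≡ suc (toℕ ℓ) + k
  toℕ-leaf ℓ = cong suc (trans (toℕ-↑ʳ k ℓ) (+-comm k (toℕ ℓ)))

  mid-injective : ∀ {ℓ ℓ'} → mid ℓ ≡ mid ℓ' → ℓ ≡ ℓ'
  mid-injective = ↑ˡ-injective k _ _ ∘ suc-injective

  leaf-injective : ∀ {ℓ ℓ'} → leaf ℓ ≡ leaf ℓ' → ℓ ≡ ℓ'
  leaf-injective = ↑ʳ-injective k _ _ ∘ suc-injective

  mid≢leaf : ∀ {ℓ ℓ'} → mid ℓ ≢ leaf ℓ'
  mid≢leaf {ℓ} {ℓ'} eq with begin
    inj₁ ℓ             ≡⟨ splitAt-↑ˡ k ℓ k ⟨
    splitAt k (ℓ ↑ˡ k)  ≡⟨ cong (splitAt k) (suc-injective eq) ⟩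
    splitAt k (k ↑ʳ ℓ') ≡⟨ splitAt-↑ʳ k k ℓ' ⟩
    inj₂ ℓ'            ∎
    where open ≡-Reasoning
  ... | ()

  -- SpiderAdj k speaks about vertex numbers; matching on this view refines the vertices.
  data SpiderEdge : Vertex k → Vertex k → Set where
    spoke    : ∀ ℓ → SpiderEdge centre (mid ℓ)
    spoke⁻   : ∀ ℓ → SpiderEdge (mid ℓ) centre
    pendant  : ∀ ℓ → SpiderEdge (mid ℓ) (leaf ℓ)
    pendant⁻ : ∀ ℓ → SpiderEdge (leaf ℓ) (mid ℓ)

  edge⇒adj : ∀ {u v} → SpiderEdge u v → SpiderAdj k u v
  edge⇒adj (spoke ℓ) =
    subst (SpiderAdjℕ k 0) (sym (toℕ-mid ℓ)) (centre-mid _ (s≤s z≤n) (toℕ<n ℓ))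
  edge⇒adj (spoke⁻ ℓ) =
    subst (λ x → SpiderAdjℕ k x 0) (sym (toℕ-mid ℓ)) (mid-centre _ (s≤s z≤n) (toℕ<n ℓ))
  edge⇒adj (pendant ℓ) =
    subst₂ (SpiderAdjℕ k) (sym (toℕ-mid ℓ)) (sym (toℕ-leaf ℓ)) (mid-leaf _ (s≤s z≤n) (toℕ<n ℓ))
  edge⇒adj (pendant⁻ ℓ) =
    subst₂ (SpiderAdjℕ k) (sym (toℕ-leaf ℓ)) (sym (toℕ-mid ℓ)) (leaf-mid _ (s≤s z≤n) (toℕ<n ℓ))

  adj⇒edge : ∀ {u v} → SpiderAdj k u v → SpiderEdge u v
  adj⇒edge {u} {v} adj = classify adj refl refl
    where
    centre-at : ∀ {w} → toℕ w ≡ 0 → centre ≡ w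
    centre-at w≡0 = toℕ-injective (sym w≡0)
    mid-at : ∀ {i w} (i<k : i < k) → toℕ w ≡ suc i → mid (fromℕ< i<k) ≡ w
    mid-at i<k w≡ = toℕ-injective (trans (toℕ-mid _) (trans (cong suc (toℕ-fromℕ< i<k)) (sym w≡)))
    leaf-at : ∀ {i w} (i<k : i < k) → toℕ w ≡ suc i + k → leaf (fromℕ< i<k) ≡ w
    leaf-at i<k w≡ =
      toℕ-injective (trans (toℕ-leaf _) (trans (cong (λ j → suc j + k) (toℕ-fromℕ< i<k)) (sym w≡)))
    classify : ∀ {x y} → SpiderAdjℕ k x y → toℕ u ≡ x → toℕ v ≡ y → SpiderEdge u v
    classify (centre-mid _ (s≤s z≤n) i<k) u≡ v≡ =
      subst₂ SpiderEdge (centre-at u≡) (mid-at i<k v≡) (spoke _)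
    classify (mid-centre _ (s≤s z≤n) i<k) u≡ v≡ =
      subst₂ SpiderEdge (mid-at i<k u≡) (centre-at v≡) (spoke⁻ _)
    classify (mid-leaf _ (s≤s z≤n) i<k) u≡ v≡ =
      subst₂ SpiderEdge (mid-at i<k u≡) (leaf-at i<k v≡) (pendant _)
    classify (leaf-mid _ (s≤s z≤n) i<k) u≡ v≡ =
      subst₂ SpiderEdge (leaf-at i<k u≡) (mid-at i<k v≡) (pendant⁻ _)

  OnLeg : Fin k → Vertex k → Set
  OnLeg ℓ = InPair (mid ℓ) (leaf ℓ)

  centre-offLeg : ∀ {ℓ} → ¬ OnLeg ℓ centre
  centre-offLeg (inj₁ ())
  centre-offLeg (inj₂ ())

  onLeg-unique : ∀ {ℓ ℓ' u} → OnLeg ℓ u → OnLeg ℓ' u → ℓ ≡ ℓ'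
  onLeg-unique (inj₁ refl) (inj₁ eq) = mid-injective eq
  onLeg-unique (inj₁ refl) (inj₂ eq) = ⊥-elim (mid≢leaf eq)
  onLeg-unique (inj₂ refl) (inj₁ eq) = ⊥-elim (mid≢leaf (sym eq))
  onLeg-unique (inj₂ refl) (inj₂ eq) = leaf-injective eq

  edge-onLegs : ∀ {ℓ ℓ' u v} → SpiderEdge u v → OnLeg ℓ u → OnLeg ℓ' v → ℓ ≡ ℓ'
  edge-onLegs (spoke _)    u∈ _  = ⊥-elim (centre-offLeg u∈)
  edge-onLegs (spoke⁻ _)   _  v∈ = ⊥-elim (centre-offLeg v∈)
  edge-onLegs (pendant _)  u∈ v∈ = trans (onLeg-unique u∈ (inj₁ refl)) (onLeg-unique (inj₂ refl) v∈)
  edge-onLegs (pendant⁻ _) u∈ v∈ = trans (onLeg-unique u∈ (inj₂ refl)) (onLeg-unique (inj₁ refl) v∈)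

  pendants-induced2K2 : ∀ {ℓ ℓ'} → ℓ ≢ ℓ' →
    Induced2K2 (SpiderAdj k) (mid ℓ) (leaf ℓ) (mid ℓ') (leaf ℓ')
  pendants-induced2K2 {ℓ} {ℓ'} ℓ≢ℓ' =
    mid≢leaf , apart (inj₁ refl) (inj₁ refl) , apart (inj₁ refl) (inj₂ refl) ,
    apart (inj₂ refl) (inj₁ refl) , apart (inj₂ refl) (inj₂ refl) , mid≢leaf ,
    edge⇒adj (pendant ℓ) , edge⇒adj (pendant ℓ') ,
    nonadjacent (inj₁ refl) (inj₁ refl) , nonadjacent (inj₁ refl) (inj₂ refl) ,
    nonadjacent (inj₂ refl) (inj₁ refl) , nonadjacent (inj₂ refl) (inj₂ refl)
    where
    apart : ∀ {u v} → OnLeg ℓ u → OnLeg ℓ' v → u ≢ v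
    apart u∈ v∈ refl = ℓ≢ℓ' (onLeg-unique u∈ v∈)
    nonadjacent : ∀ {u v} → OnLeg ℓ u → OnLeg ℓ' v → ¬ SpiderAdj k u v
    nonadjacent u∈ v∈ adj = ℓ≢ℓ' (edge-onLegs (adj⇒edge adj) u∈ v∈)

  DistinctPendants : Vertex k → Vertex k → Vertex k → Vertex k → Set
  DistinctPendants a b c d =
    Σ (Fin k) λ ℓ → Σ (Fin k) λ ℓ' →
      ℓ ≢ ℓ' × SamePair a b (mid ℓ) (leaf ℓ) × SamePair c d (mid ℓ') (leaf ℓ')

  -- A spoke shares the centre with any other spoke and is joined through the centre to the
  -- mid vertex of any pendant edge, so an induced 2K₂ contains no spoke.
  induced2K2⇒distinctPendants : ∀ {a b c d} →
    Induced2K2 (SpiderAdj k) a b c d → DistinctPendants a b c d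
  induced2K2⇒distinctPendants (_ , a≢c , a≢d , b≢c , b≢d , _ , ab , cd , ¬ac , ¬ad , ¬bc , ¬bd) =
    from-edges (adj⇒edge ab) (adj⇒edge cd) a≢c a≢d b≢c b≢d
      (¬ac ∘ edge⇒adj) (¬ad ∘ edge⇒adj) (¬bc ∘ edge⇒adj) (¬bd ∘ edge⇒adj)
    where
    from-edges : ∀ {a b c d} → SpiderEdge a b → SpiderEdge c d →
      a ≢ c → a ≢ d → b ≢ c → b ≢ d →
      ¬ SpiderEdge a c → ¬ SpiderEdge a d → ¬ SpiderEdge b c → ¬ SpiderEdge b d →
      DistinctPendants a b c d
    from-edges (spoke _)    (spoke _)     a≢c _ _ _ _ _ _ _ = ⊥-elim (a≢c refl)
    from-edges (spoke _)    (spoke⁻ _)    _ a≢d _ _ _ _ _ _ = ⊥-elim (a≢d refl)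
    from-edges (spoke _)    (pendant ℓ')  _ _ _ _ ¬ac _ _ _ = ⊥-elim (¬ac (spoke ℓ'))
    from-edges (spoke _)    (pendant⁻ ℓ') _ _ _ _ _ ¬ad _ _ = ⊥-elim (¬ad (spoke ℓ'))
    from-edges (spoke⁻ _)   (spoke _)     _ _ b≢c _ _ _ _ _ = ⊥-elim (b≢c refl)
    from-edges (spoke⁻ _)   (spoke⁻ _)    _ _ _ b≢d _ _ _ _ = ⊥-elim (b≢d refl)
    from-edges (spoke⁻ _)   (pendant ℓ')  _ _ _ _ _ _ ¬bc _ = ⊥-elim (¬bc (spoke ℓ'))
    from-edges (spoke⁻ _)   (pendant⁻ ℓ') _ _ _ _ _ _ _ ¬bd = ⊥-elim (¬bd (spoke ℓ'))
    from-edges (pendant ℓ)  (spoke _)     _ _ _ _ ¬ac _ _ _ = ⊥-elim (¬ac (spoke⁻ ℓ))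
    from-edges (pendant ℓ)  (spoke⁻ _)    _ _ _ _ _ ¬ad _ _ = ⊥-elim (¬ad (spoke⁻ ℓ))
    from-edges (pendant⁻ ℓ) (spoke _)     _ _ _ _ _ _ ¬bc _ = ⊥-elim (¬bc (spoke⁻ ℓ))
    from-edges (pendant⁻ ℓ) (spoke⁻ _)    _ _ _ _ _ _ _ ¬bd = ⊥-elim (¬bd (spoke⁻ ℓ))
    from-edges (pendant ℓ)  (pendant ℓ')  a≢c _ _ _ _ _ _ _ = ℓ , ℓ' , a≢c ∘ cong mid , same , same
    from-edges (pendant ℓ)  (pendant⁻ ℓ') _ a≢d _ _ _ _ _ _ = ℓ , ℓ' , a≢d ∘ cong mid , same , swapped
    from-edges (pendant⁻ ℓ) (pendant ℓ')  _ _ b≢c _ _ _ _ _ = ℓ , ℓ' , b≢c ∘ cong mid , swapped , same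
    from-edges (pendant⁻ ℓ) (pendant⁻ ℓ') _ _ _ b≢d _ _ _ _ = ℓ , ℓ' , b≢d ∘ cong mid , swapped , swapped

module _ {k m : ℕ} {f : Vertex k → Fin m} where

  pairInjective⇒2K2Avoiding : IsProper (SpiderAdj k) f → PairInjective (f ∘ mid) (f ∘ leaf) →
    Is2K2Avoiding (SpiderAdj k) f
  pairInjective⇒2K2Avoiding proper injective = proper , no-induced2K2
    where
    no-induced2K2 : ∀ p q a b c d →
      InPair p q (f a) → InPair p q (f b) → InPair p q (f c) → InPair p q (f d) →
      ¬ Induced2K2 (SpiderAdj k) a b c d
    no-induced2K2 _ _ a b c d a∈ b∈ c∈ d∈ induced@(_ , _ , _ , _ , _ , _ , ab , cd , _)
      with induced2K2⇒distinctPendants induced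
    ... | ℓ , ℓ' , ℓ≢ℓ' , ab≐pendant , cd≐pendant = ℓ≢ℓ' (injective ℓ ℓ'
          (samePair-trans (samePair-sym (samePair-map f ab≐pendant))
            (samePair-trans (inPair⇒samePair a∈ b∈ c∈ d∈ (proper a b ab) (proper c d cd))
              (samePair-map f cd≐pendant))))

  2K2Avoiding⇒pairInjective : Is2K2Avoiding (SpiderAdj k) f → PairInjective (f ∘ mid) (f ∘ leaf)
  2K2Avoiding⇒pairInjective (_ , no-induced2K2) ℓ ℓ' colours =
    decidable-stable (ℓ ≟ ℓ') λ ℓ≢ℓ' →
      no-induced2K2 _ _ (mid ℓ) (leaf ℓ) (mid ℓ') (leaf ℓ') (inj₁ refl) (inj₂ refl)
        (proj₁ (samePair⇒inPair colours)) (proj₂ (samePair⇒inPair colours))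
        (pendants-induced2K2 ℓ≢ℓ')

spiderColouring : ∀ {k m} → Fin m → (Fin k → Fin m) → (Fin k → Fin m) → Vertex k → Fin m
spiderColouring c₀ A B zero        = c₀
spiderColouring {k} c₀ A B (suc w) = [ A , B ]′ (splitAt k w)

module _ {k m : ℕ} {c₀ : Fin m} {A B : Fin k → Fin m} where

  spiderColouring-mid : ∀ ℓ → spiderColouring c₀ A B (mid ℓ) ≡ A ℓ
  spiderColouring-mid ℓ = cong [ A , B ]′ (splitAt-↑ˡ k ℓ k)

  spiderColouring-leaf : ∀ ℓ → spiderColouring c₀ A B (leaf ℓ) ≡ B ℓ
  spiderColouring-leaf ℓ = cong [ A , B ]′ (splitAt-↑ʳ k k ℓ)

  spiderColouring-proper : (∀ ℓ → c₀ ≢ A ℓ) → (∀ ℓ → A ℓ ≢ B ℓ) →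
    IsProper (SpiderAdj k) (spiderColouring c₀ A B)
  spiderColouring-proper c₀≢A A≢B u v adj = edge-coloured (adj⇒edge {u = u} {v} adj)
    where
    edge-coloured : ∀ {u v} → SpiderEdge {k} u v →
      spiderColouring c₀ A B u ≢ spiderColouring c₀ A B v
    edge-coloured (spoke ℓ)    rewrite spiderColouring-mid ℓ = c₀≢A ℓ
    edge-coloured (spoke⁻ ℓ)   rewrite spiderColouring-mid ℓ = c₀≢A ℓ ∘ sym
    edge-coloured (pendant ℓ)  rewrite spiderColouring-mid ℓ | spiderColouring-leaf ℓ = A≢B ℓ
    edge-coloured (pendant⁻ ℓ) rewrite spiderColouring-mid ℓ | spiderColouring-leaf ℓ = A≢B ℓ ∘ sym

≤C2⇒2K2AvoidingColouring : ∀ {k m} → 1 ≤ m → k ≤ m C 2 → Has2K2AvoidingColouring (SpiderAdj k) m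
≤C2⇒2K2AvoidingColouring {k} {suc m} _ k≤m₂ = f , pairInjective⇒2K2Avoiding proper legPairs
  where
  P : Fin k → OrderedPair (suc m)
  P = proj₁ (≤C2⇒∃pairInjective k≤m₂)
  P-injective : PairInjective (hi ∘ P) (lo ∘ P)
  P-injective = proj₂ (≤C2⇒∃pairInjective k≤m₂)
  f : Vertex k → Fin (suc m)
  f = spiderColouring zero (hi ∘ P) (lo ∘ P)
  proper : IsProper (SpiderAdj k) f
  proper = spiderColouring-proper (λ ℓ → <⇒≢ (≤-<-trans z≤n (lo<hi (P ℓ))) ∘ cong toℕ)
                                  (λ ℓ → >⇒≢ (lo<hi (P ℓ)) ∘ cong toℕ)
  f-mid : ∀ ℓ → f (mid ℓ) ≡ hi (P ℓ)
  f-mid = spiderColouring-mid {c₀ = zero} {hi ∘ P} {lo ∘ P}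
  f-leaf : ∀ ℓ → f (leaf ℓ) ≡ lo (P ℓ)
  f-leaf = spiderColouring-leaf {c₀ = zero} {hi ∘ P} {lo ∘ P}
  legPairs : PairInjective (f ∘ mid) (f ∘ leaf)
  legPairs ℓ ℓ' rewrite f-mid ℓ | f-leaf ℓ | f-mid ℓ' | f-leaf ℓ' = P-injective ℓ ℓ'

2K2AvoidingColouring⇒≤C2 : ∀ {k c} → Has2K2AvoidingColouring (SpiderAdj k) c → 1 ≤ c × k ≤ c C 2
2K2AvoidingColouring⇒≤C2 {k} (f , avoiding@(proper , _)) =
  ≤-<-trans z≤n (toℕ<n (f (centre {k}))) ,
  pairInjective⇒≤C2 (f ∘ mid) (f ∘ leaf) (λ ℓ → proper _ _ (edge⇒adj (pendant ℓ)))
    (2K2Avoiding⇒pairInjective avoiding)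

4[1+a+a]≤4[1+b+b]⇒a≤b : ∀ {a b} → 4 * suc (a + a) ≤ 4 * suc (b + b) → a ≤ b
4[1+a+a]≤4[1+b+b]⇒a≤b le = ≮⇒≥ λ b<a → <⇒≱ (*-monoʳ-< 4 (s<s (+-mono-< b<a b<a))) le

4[1+a+a]<4[1+b+b]⇒a<b : ∀ {a b} → 4 * suc (a + a) < 4 * suc (b + b) → a < b
4[1+a+a]<4[1+b+b]⇒a<b lt = ≰⇒> λ b≤a → <⇒≱ lt (*-monoʳ-≤ 4 (s≤s (+-mono-≤ b≤a b≤a)))

oddSquare+3 : ∀ n → (2 * n + 1) ^ 2 + 3 ≡ 4 * suc (suc n C 2 + suc n C 2)
oddSquare+3 n = begin
  (2 * n + 1) ^ 2 + 3              ≡⟨ expand n ⟩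
  4 * suc (n * n + n)              ≡⟨ cong (λ t → 4 * suc t) ([1+n]C2+[1+n]C2≡n*n+n n) ⟨
  4 * suc (suc n C 2 + suc n C 2)  ∎
  where
  open ≡-Reasoning
  -- x ^ 2 unfolds to x * (x * 1); the ring solver does not handle _^_ itself.
  expand : ∀ x → (2 * x + 1) * ((2 * x + 1) * 1) + 3 ≡ 4 * suc (x * x + x)
  expand = solve-∀

2[1+n]∸1≡2n+1 : ∀ n → 2 * suc n ∸ 1 ≡ 2 * n + 1
2[1+n]∸1≡2n+1 n = trans (cong (_∸ 1) (shift n)) (m+n∸m≡n 1 (2 * n + 1))
  where
  shift : ∀ n → 2 * suc n ≡ 1 + (2 * n + 1)
  shift = solve-∀

2[2+n]∸3≡2n+1 : ∀ n → 2 * suc (suc n) ∸ 3 ≡ 2 * n + 1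
2[2+n]∸3≡2n+1 n = trans (cong (_∸ 3) (shift n)) (m+n∸m≡n 3 (2 * n + 1))
  where
  shift : ∀ n → 2 * suc (suc n) ≡ 3 + (2 * n + 1)
  shift = solve-∀

ceilSqrtFormula⇒≤C2 : ∀ {k m} → IsCeilSqrtFormula (suc (k + k)) m → k ≤ m C 2
ceilSqrtFormula⇒≤C2 {k} {suc n} ((_ , upper) , _) = 4[1+a+a]≤4[1+b+b]⇒a≤b (begin
  4 * suc (k + k)                  ≤⟨ upper ⟩
  (2 * suc n ∸ 1) ^ 2 + 3          ≡⟨ cong (λ x → x ^ 2 + 3) (2[1+n]∸1≡2n+1 n) ⟩
  (2 * n + 1) ^ 2 + 3              ≡⟨ oddSquare+3 n ⟩
  4 * suc (suc n C 2 + suc n C 2)  ∎)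
  where open ≤-Reasoning

ceilSqrtFormula-least : ∀ {k m c} → IsCeilSqrtFormula (suc (k + k)) m → 1 ≤ c → k ≤ c C 2 → m ≤ c
ceilSqrtFormula-least {m = zero}        _                _   _    = z≤n
ceilSqrtFormula-least {m = suc zero}    _                1≤c _    = 1≤c
ceilSqrtFormula-least {m = suc (suc n)} (_ , inj₁ 2m<3)  _   _    =
  ⊥-elim (<⇒≱ 2m<3 (≤-trans (n≤1+n 3) (*-monoʳ-≤ 2 (s≤s (s≤s z≤n)))))
ceilSqrtFormula-least {k} {suc (suc n)} (_ , inj₂ lower) _   k≤c₂ =
  ≰⇒> λ c≤1+n → <⇒≱ C2<k (≤-trans k≤c₂ (C2-mono-≤ c≤1+n))
  where
  open ≤-Reasoning
  C2<k : suc n C 2 < k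
  C2<k = 4[1+a+a]<4[1+b+b]⇒a<b (begin-strict
    4 * suc (suc n C 2 + suc n C 2)  ≡⟨ oddSquare+3 n ⟨
    (2 * n + 1) ^ 2 + 3              ≡⟨ cong (λ x → x ^ 2 + 3) (2[2+n]∸3≡2n+1 n) ⟨
    (2 * suc (suc n) ∸ 3) ^ 2 + 3    <⟨ lower ⟩
    4 * suc (k + k)                  ∎)

corollary5p4 : (k m : ℕ) → IsCeilSqrtFormula (suc (k + k)) m → Chi2K2≡ (SpiderAdj k) m
corollary5p4 k m formula@((1≤m , _) , _) =
  ≤C2⇒2K2AvoidingColouring 1≤m (ceilSqrtFormula⇒≤C2 formula) ,
  λ c → uncurry (ceilSqrtFormula-least formula) ∘ 2K2AvoidingColouring⇒≤C2
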